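{- The theory of the structure $\langle\mathbb{Q}^+;<,\times\rangle$ (positive rationals with usual order and multiplication) does not admit quantifier elimination.
   Context: A structure admits quantifier elimination if every formula of its language is equivalent in the structure to a quantifier-free formula of the same language with the same free variables. -}

module Defs where

open import Data.Nat using (ℕ; suc)
open import Data.Fin using (Fin; zero; suc)
open import Data.Product using (Σ; _×_; _,_)
open import Data.Sum using (_⊎_)
open import Data.Unit using (⊤)
open import Data.Empty using (⊥)
open import Relation.Nullary using (¬_)
open import Relation.Binary.PropositionalEquality using (_≡_)
open import Function.Bundles using (_⇔_)
open import Data.Rational as ℚ using (ℚ; Positive)
open import Data.Rational.Properties using (pos*pos⇒pos)

record ℚ⁺ : Set where
  constructor mkℚ⁺
  field
    val : ℚ
    .{{pos}} : Positive val
open ℚ⁺ public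

_·_ : ℚ⁺ → ℚ⁺ → ℚ⁺
mkℚ⁺ p ·  mkℚ⁺ q = mkℚ⁺ (p ℚ.* q) {{pos*pos⇒pos p q}}

-- equality of elements of ℚ⁺ (ℚ is normalised, so this is equality of rationals)
_≈⁺_ : ℚ⁺ → ℚ⁺ → Set
x ≈⁺ y = val x ≡ val y

_<⁺_ : ℚ⁺ → ℚ⁺ → Set
x <⁺ y = val x ℚ.< val y

-- First-order language {<, ×} (with equality), formulas with free
-- variables among Fin n (de Bruijn, variable 0 bound by the innermost
-- quantifier).

data Term (n : ℕ) : Set where
  var  : Fin n → Term n
  _⊗_  : Term n → Term n → Term n

data Formula : ℕ → Set where
  ⊤ᶠ ⊥ᶠ : ∀ {n} → Formula n
  _≐_   : ∀ {n} → Term n → Term n → Formula n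
  _≺_   : ∀ {n} → Term n → Term n → Formula n
  ¬ᶠ_   : ∀ {n} → Formula n → Formula n
  _∧ᶠ_ _∨ᶠ_ _⇒ᶠ_ : ∀ {n} → Formula n → Formula n → Formula n
  ∃ᶠ ∀ᶠ : ∀ {n} → Formula (suc n) → Formula n

data QuantifierFree : ∀ {n} → Formula n → Set where
  ⊤-qf : ∀ {n} → QuantifierFree {n} ⊤ᶠ
  ⊥-qf : ∀ {n} → QuantifierFree {n} ⊥ᶠ
  ≐-qf : ∀ {n} (s t : Term n) → QuantifierFree (s ≐ t)
  ≺-qf : ∀ {n} (s t : Term n) → QuantifierFree (s ≺ t)
  ¬-qf : ∀ {n} {φ : Formula n} → QuantifierFree φ → QuantifierFree (¬ᶠ φ)
  ∧-qf : ∀ {n} {φ ψ : Formula n} → QuantifierFree φ → QuantifierFree ψ → QuantifierFree (φ ∧ᶠ ψ)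
  ∨-qf : ∀ {n} {φ ψ : Formula n} → QuantifierFree φ → QuantifierFree ψ → QuantifierFree (φ ∨ᶠ ψ)
  ⇒-qf : ∀ {n} {φ ψ : Formula n} → QuantifierFree φ → QuantifierFree ψ → QuantifierFree (φ ⇒ᶠ ψ)

Env : ℕ → Set
Env n = Fin n → ℚ⁺

extend : ∀ {n} → ℚ⁺ → Env n → Env (suc n)
extend a ρ zero    = a
extend a ρ (suc i) = ρ i

⟦_⟧ₜ : ∀ {n} → Term n → Env n → ℚ⁺
⟦ var i ⟧ₜ ρ = ρ i
⟦ s ⊗ t ⟧ₜ ρ = ⟦ s ⟧ₜ ρ · ⟦ t ⟧ₜ ρ

⟦_⟧ : ∀ {n} → Formula n → Env n → Set
⟦ ⊤ᶠ ⟧ ρ = ⊤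
⟦ ⊥ᶠ ⟧ ρ = ⊥
⟦ s ≐ t ⟧ ρ = ⟦ s ⟧ₜ ρ ≈⁺ ⟦ t ⟧ₜ ρ
⟦ s ≺ t ⟧ ρ = ⟦ s ⟧ₜ ρ <⁺ ⟦ t ⟧ₜ ρ
⟦ ¬ᶠ φ ⟧ ρ = ¬ ⟦ φ ⟧ ρ
⟦ φ ∧ᶠ ψ ⟧ ρ = ⟦ φ ⟧ ρ × ⟦ ψ ⟧ ρ
⟦ φ ∨ᶠ ψ ⟧ ρ = ⟦ φ ⟧ ρ ⊎ ⟦ ψ ⟧ ρ
⟦ φ ⇒ᶠ ψ ⟧ ρ = ⟦ φ ⟧ ρ → ⟦ ψ ⟧ ρ
⟦ ∃ᶠ φ ⟧ ρ = Σ ℚ⁺ λ a → ⟦ φ ⟧ (extend a ρ)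
⟦ ∀ᶠ φ ⟧ ρ = (a : ℚ⁺) → ⟦ φ ⟧ (extend a ρ)

AdmitsQE : Set
AdmitsQE = ∀ {n} (φ : Formula n) →
  Σ (Formula n) λ ψ → QuantifierFree ψ × (∀ (ρ : Env n) → ⟦ φ ⟧ ρ ⇔ ⟦ ψ ⟧ ρ)

-- Squaring x ↦ x² is an embedding of ⟨ℚ⁺ ; < , ×⟩ into itself: it is a
-- strictly increasing multiplicative map.  Embeddings preserve and reflect
-- quantifier-free formulas, so under quantifier elimination they would
-- preserve and reflect every formula.  But "x is a square" holds of 4 = 2²
-- and fails of 2, since √2 is irrational.
module Submission where

open import Defs
open import Relation.Nullary using (¬_)

open import Data.Nat as ℕ using (ℕ)
open import Data.Nat.Properties using (*-comm; *-cancelˡ-≡)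
open import Data.Nat.Divisibility using (_∣_; divides)
open import Data.Nat.Primality using (euclidsLemma; prime[2])
open import Data.Nat.Coprimality as Coprimality using (Coprime)
open import Data.Nat.Tactic.RingSolver using (solve-∀)
open import Data.Integer as ℤ using (+_)
import Data.Integer.Properties as ℤ
open import Data.Rational as ℚ using (ℚ; mkℚ)
import Data.Rational.Properties as ℚ
import Data.Rational.Unnormalised as ℚᵘ
import Data.Rational.Unnormalised.Properties as ℚᵘ
open import Algebra.Bundles using (CommutativeMonoid)
open import Algebra.Properties.CommutativeSemigroup
  (CommutativeMonoid.commutativeSemigroup ℚ.*-1-commutativeMonoid) using (interchange)
open import Data.Fin using (zero; suc)
open import Data.Product using (_,_)
open import Data.Product.Function.NonDependent.Propositional using (_×-⇔_)
open import Data.Sum using ([_,_]′)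
open import Data.Sum.Function.Propositional using (_⊎-⇔_)
open import Data.Empty using (⊥-elim)
open import Function using (_∘_; id; const)
open import Function.Bundles using (_⇔_; mk⇔; Equivalence)
open import Function.Construct.Identity using (⇔-id)
open import Function.Construct.Symmetry using (⇔-sym)
open import Function.Construct.Composition using (_⇔-∘_)
open import Function.Related.TypeIsomorphisms using (→-cong-⇔; ¬-cong-⇔)
open import Relation.Binary.PropositionalEquality
open import Relation.Binary.Definitions using (tri<; tri≈; tri>)

2∣m*m⇒2∣m : ∀ m → 2 ∣ m ℕ.* m → 2 ∣ m
2∣m*m⇒2∣m m 2∣m*m = [ id , id ]′ (euclidsLemma m m prime[2] 2∣m*m)

[2k]²≡2*2k² : ∀ k → (k ℕ.* 2) ℕ.* (k ℕ.* 2) ≡ 2 ℕ.* (2 ℕ.* (k ℕ.* k))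
[2k]²≡2*2k² = solve-∀

coprime-m²≢2n² : ∀ m n → Coprime m n → m ℕ.* m ≢ 2 ℕ.* (n ℕ.* n)
coprime-m²≢2n² m n coprime m²≡2n²
  with 2∣m*m⇒2∣m m (divides (n ℕ.* n) (trans m²≡2n² (*-comm 2 (n ℕ.* n))))
... | divides k refl with 2∣m*m⇒2∣m n (divides (k ℕ.* k) (trans n²≡2k² (*-comm 2 (k ℕ.* k))))
  where
  n²≡2k² : n ℕ.* n ≡ 2 ℕ.* (k ℕ.* k)
  n²≡2k² = sym (*-cancelˡ-≡ _ _ 2 (trans (sym ([2k]²≡2*2k² k)) m²≡2n²))
... | divides j refl with coprime (divides k refl , divides j refl)
... | ()

q*q≢2 : (q : ℚ) → q ℚ.* q ≢ + 2 ℚ./ 1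
q*q≢2 q@(mkℚ n d-1 coprime) q*q≡2
  with ℚᵘ.≃-trans (ℚᵘ.≃-sym (ℚ.toℚᵘ-homo-* q q)) (ℚ.toℚᵘ-cong q*q≡2)
... | ℚᵘ.*≡* n*n*1≡2*d*d = coprime-m²≢2n² ℤ.∣ n ∣ d (Coprimality.recompute coprime) (begin
  ℤ.∣ n ∣ ℕ.* ℤ.∣ n ∣       ≡⟨ ℤ.abs-* n n ⟨
  ℤ.∣ n ℤ.* n ∣             ≡⟨ cong ℤ.∣_∣ (ℤ.*-identityʳ (n ℤ.* n)) ⟨
  ℤ.∣ n ℤ.* n ℤ.* + 1 ∣     ≡⟨ cong ℤ.∣_∣ n*n*1≡2*d*d ⟩
  2 ℕ.* (d ℕ.* d)           ∎)
  where
  d : ℕ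
  d = ℕ.suc d-1
  open ≡-Reasoning

≈⁺⇒≡ : ∀ {a b : ℚ⁺} → a ≈⁺ b → a ≡ b
≈⁺⇒≡ refl = refl

record IsEmbedding (f : ℚ⁺ → ℚ⁺) : Set where
  field
    ·-homo : ∀ a b → f (a · b) ≈⁺ (f a · f b)
    <-mono : ∀ {a b} → a <⁺ b → f a <⁺ f b

  ≈-cong : ∀ {a b} → a ≈⁺ b → f a ≈⁺ f b
  ≈-cong = cong (val ∘ f) ∘ ≈⁺⇒≡

  <-reflect : ∀ {a b} → f a <⁺ f b → a <⁺ b
  <-reflect {a} {b} fa<fb with ℚ.<-cmp (val a) (val b)
  ... | tri< a<b _ _ = a<b
  ... | tri≈ _ a≈b _ = ⊥-elim (ℚ.<-irrefl (≈-cong a≈b) fa<fb)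
  ... | tri> _ _ b<a = ⊥-elim (ℚ.<-asym fa<fb (<-mono b<a))

  injective : ∀ {a b} → f a ≈⁺ f b → a ≈⁺ b
  injective {a} {b} fa≈fb with ℚ.<-cmp (val a) (val b)
  ... | tri< a<b _ _ = ⊥-elim (ℚ.<-irrefl fa≈fb (<-mono a<b))
  ... | tri≈ _ a≈b _ = a≈b
  ... | tri> _ _ b<a = ⊥-elim (ℚ.<-irrefl (sym fa≈fb) (<-mono b<a))

module _ {f : ℚ⁺ → ℚ⁺} (emb : IsEmbedding f) where
  open IsEmbedding emb

  ⟦⟧ₜ-∘ : ∀ {n} (t : Term n) (ρ : Env n) → ⟦ t ⟧ₜ (f ∘ ρ) ≈⁺ f (⟦ t ⟧ₜ ρ)
  ⟦⟧ₜ-∘ (var i) ρ = refl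
  ⟦⟧ₜ-∘ (s ⊗ t) ρ =
    trans (cong₂ ℚ._*_ (⟦⟧ₜ-∘ s ρ) (⟦⟧ₜ-∘ t ρ)) (sym (·-homo (⟦ s ⟧ₜ ρ) (⟦ t ⟧ₜ ρ)))

  quantifierFree-∘ : ∀ {n} {φ : Formula n} → QuantifierFree φ → (ρ : Env n) →
                     ⟦ φ ⟧ ρ ⇔ ⟦ φ ⟧ (f ∘ ρ)
  quantifierFree-∘ ⊤-qf ρ = ⇔-id _
  quantifierFree-∘ ⊥-qf ρ = ⇔-id _
  quantifierFree-∘ (≐-qf s t) ρ = mk⇔
    (λ s≈t → trans (⟦⟧ₜ-∘ s ρ) (trans (≈-cong s≈t) (sym (⟦⟧ₜ-∘ t ρ))))
    (λ s≈t → injective (trans (sym (⟦⟧ₜ-∘ s ρ)) (trans s≈t (⟦⟧ₜ-∘ t ρ))))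
  quantifierFree-∘ (≺-qf s t) ρ = mk⇔
    (λ s<t → subst₂ ℚ._<_ (sym (⟦⟧ₜ-∘ s ρ)) (sym (⟦⟧ₜ-∘ t ρ)) (<-mono s<t))
    (λ s<t → <-reflect (subst₂ ℚ._<_ (⟦⟧ₜ-∘ s ρ) (⟦⟧ₜ-∘ t ρ) s<t))
  quantifierFree-∘ (¬-qf φ) ρ = ¬-cong-⇔ (quantifierFree-∘ φ ρ)
  quantifierFree-∘ (∧-qf φ ψ) ρ = quantifierFree-∘ φ ρ ×-⇔ quantifierFree-∘ ψ ρ
  quantifierFree-∘ (∨-qf φ ψ) ρ = quantifierFree-∘ φ ρ ⊎-⇔ quantifierFree-∘ ψ ρ
  quantifierFree-∘ (⇒-qf φ ψ) ρ = →-cong-⇔ (quantifierFree-∘ φ ρ) (quantifierFree-∘ ψ ρ)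

  AdmitsQE⇒⟦⟧-∘ : AdmitsQE → ∀ {n} (φ : Formula n) (ρ : Env n) → ⟦ φ ⟧ ρ ⇔ ⟦ φ ⟧ (f ∘ ρ)
  AdmitsQE⇒⟦⟧-∘ qe φ ρ with qe φ
  ... | ψ , ψ-qf , φ⇔ψ = ⇔-sym (φ⇔ψ (f ∘ ρ)) ⇔-∘ (quantifierFree-∘ ψ-qf ρ ⇔-∘ φ⇔ψ ρ)

square : ℚ⁺ → ℚ⁺
square a = a · a

square-isEmbedding : IsEmbedding square
square-isEmbedding = record
  { ·-homo = λ a b → interchange (val a) (val b) (val a) (val b)
  ; <-mono = λ { {mkℚ⁺ a} {mkℚ⁺ b} a<b →
      ℚ.<-trans (ℚ.*-monoˡ-<-pos a a<b) (ℚ.*-monoʳ-<-pos b a<b) }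
  }

two⁺ : ℚ⁺
two⁺ = mkℚ⁺ (+ 2 ℚ./ 1)

isSquare : Formula 1
isSquare = ∃ᶠ ((var zero ⊗ var zero) ≐ var (suc zero))

mainTheorem8 : ¬ AdmitsQE
mainTheorem8 qe with Equivalence.from 2-isSquare⇔4-isSquare (two⁺ , refl)
  where
  2-isSquare⇔4-isSquare : ⟦ isSquare ⟧ (const two⁺) ⇔ ⟦ isSquare ⟧ (square ∘ const two⁺)
  2-isSquare⇔4-isSquare = AdmitsQE⇒⟦⟧-∘ square-isEmbedding qe isSquare (const two⁺)
... | y , y*y≡2 = q*q≢2 (val y) y*y≡2
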